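{- Let $(b_n)_{n\in\mathbb{N}}$ be the Baum--Sweet sequence. Then $(b_n)$ contains arbitrarily long runs of consecutive $0$'s (i.e. for every $k$ there is $n$ with $b_n=b_{n+1}=\dots=b_{n+k-1}=0$), and the maximal length of a run of consecutive $1$'s in $(b_n)$ is equal to $2$.
   Context: The Baum--Sweet sequence $(b_n)_{n\in\mathbb{N}}$ with values in $\{0,1\}$ is defined by $b_0=1$ and, for $n\ge 1$, $b_n=0$ if the binary expansion of $n$ contains a maximal block of consecutive $0$'s of odd length, and $b_n=1$ otherwise. Equivalently $b_0=1$, $b_{2n+1}=b_{4n}=b_n$, $b_{4n+2}=0$ for all $n\in\mathbb{N}$. -}

module Defs where

open import Data.Nat using (ℕ; zero; suc; _+_)
open import Data.Nat using (_/_; _%_; _≡ᵇ_)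
open import Data.Bool using (Bool; true; false; not; _∧_)
open import Data.List using (List; []; _∷_)

-- Binary digits of a natural number, least significant first
-- (repeated halving; the fuel argument is only for termination and is
-- always at least the number of digits when called as below).
-- For n ≥ 1 the last element of the list is the leading digit 1;
-- for n = 0 the list is empty.
digitsFuel : ℕ → ℕ → List Bool
digitsFuel zero       n = []
digitsFuel (suc fuel) zero = []
digitsFuel (suc fuel) (suc n) = (suc n % 2 ≡ᵇ 1) ∷ digitsFuel fuel (suc n / 2)

binaryDigits : ℕ → List Bool
binaryDigits n = digitsFuel n n

-- noOddZeroBlock p ds : scanning digits (LSB first) where p is the parity
-- (true = odd) of the current block of 0's; returns true iff every maximal
-- block of 0's has even length. Every maximal block of 0's in the binary
-- expansion of n ≥ 1 is terminated (on the more significant side) by a 1.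
noOddZeroBlock : Bool → List Bool → Bool
noOddZeroBlock p []          = not p
noOddZeroBlock p (false ∷ ds) = noOddZeroBlock (not p) ds
noOddZeroBlock p (true ∷ ds)  = not p ∧ noOddZeroBlock false ds

baumSweet : ℕ → ℕ
baumSweet zero = 1
baumSweet (suc n) with noOddZeroBlock false (binaryDigits (suc n))
... | true  = 1
... | false = 0

module Submission where

-- The proof rests on three recurrences of the Baum–Sweet sequence,
--   b (2n+1) = b n,   b (4n) = b n,   b (4n+2) = 0,
-- derived from the digit-scanning definition via two facts about binary
-- digits (listed least significant first): the list for 2m+1 is that of
-- m with a 1 in front, and the list for 2m (m ≥ 1) is that of m with a
-- 0 in front.
--
-- Call x *rejected* if its digits contain an odd block of
-- 0's closed by a 1 above it, so that no parity carried in from lower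
-- digits can repair it; 5 = 101₂ is rejected, and appending a digit
-- below preserves rejection.  Hence a run of k rejected numbers starting
-- at n yields one of length 2k starting at 2n, and runs of every length
-- exist.
--
-- Of n, n+1, n+2 one is ≡ 2 mod 4 (hence b = 0) unless
-- n = 4q+3, where the recurrences reduce the three values to b q,
-- b (q+1), b (2q+2).  Such triples u, u+1, 2u+2 never all carry a 1, by
-- strong induction on u, since u = 4w+3 reduces to the triple at w.  As
-- b 0 = b 1 = 1, the maximal run of 1's has length exactly 2.

open import Defs
open import Data.Nat using (ℕ; _+_; _<_; _≤_)
open import Data.Product using (_×_; ∃-syntax)
open import Relation.Binary.PropositionalEquality using (_≡_)

open import Data.Nat using (zero; suc; _*_; _/_; _%_; _≡ᵇ_; NonZero; z≤n; s≤s; z<s; s<s)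
open import Data.Nat.Properties
open import Data.Nat.DivMod using (m/n<m; [m+kn]%n≡m%n; m*n%n≡0; m*n/n≡m; +-distrib-/)
open import Data.Nat.Induction using (<-rec)
open import Data.Nat.Tactic.RingSolver using (solve)
open import Data.Bool using (Bool; true; false; not)
open import Data.Bool.Properties using (∧-zeroʳ)
open import Data.List using ([]; _∷_)
open import Data.Product using (_,_)
open import Data.Empty using (⊥)
open import Relation.Nullary using (¬_)
open import Function using (_∘_)
open import Relation.Binary.PropositionalEquality using (refl; sym; trans; cong; cong₂; subst; module ≡-Reasoning)
open ≡-Reasoning

digitsFuel-zero : ∀ f → digitsFuel f 0 ≡ []
digitsFuel-zero zero    = refl
digitsFuel-zero (suc f) = refl

half≤pred : ∀ k → suc k / 2 ≤ k
half≤pred k = ≤-pred (m/n<m (suc k) 2 (s≤s (s≤s z≤n)))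

fuel-irrelevant : ∀ {f g} n → n ≤ f → n ≤ g → digitsFuel f n ≡ digitsFuel g n
fuel-irrelevant {f} {g} zero _ _ = trans (digitsFuel-zero f) (sym (digitsFuel-zero g))
fuel-irrelevant (suc k) (s≤s k≤f) (s≤s k≤g) =
  cong ((suc k % 2 ≡ᵇ 1) ∷_)
    (fuel-irrelevant (suc k / 2) (≤-trans (half≤pred k) k≤f) (≤-trans (half≤pred k) k≤g))

digits-step : ∀ n .{{_ : NonZero n}} → binaryDigits n ≡ (n % 2 ≡ᵇ 1) ∷ binaryDigits (n / 2)
digits-step (suc k) = cong ((suc k % 2 ≡ᵇ 1) ∷_) (fuel-irrelevant (suc k / 2) (half≤pred k) ≤-refl)

even%2 : ∀ m → (2 * m) % 2 ≡ 0
even%2 m = trans (cong (_% 2) (*-comm 2 m)) (m*n%n≡0 m 2)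

even/2 : ∀ m → (2 * m) / 2 ≡ m
even/2 m = trans (cong (_/ 2) (*-comm 2 m)) (m*n/n≡m m 2)

odd%2 : ∀ m → (1 + 2 * m) % 2 ≡ 1
odd%2 m = trans (cong (λ x → (1 + x) % 2) (*-comm 2 m)) ([m+kn]%n≡m%n 1 m 2)

odd/2 : ∀ m → (1 + 2 * m) / 2 ≡ m
odd/2 m = trans (+-distrib-/ 1 (2 * m) (subst (λ r → 1 + r < 2) (sym (even%2 m)) ≤-refl)) (even/2 m)

digits-odd : ∀ m → binaryDigits (1 + 2 * m) ≡ true ∷ binaryDigits m
digits-odd m = trans (digits-step (1 + 2 * m))
  (cong₂ _∷_ (cong (_≡ᵇ 1) (odd%2 m)) (cong binaryDigits (odd/2 m)))

digits-double : ∀ m .{{_ : NonZero m}} → binaryDigits (2 * m) ≡ false ∷ binaryDigits m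
digits-double m@(suc _) = trans (digits-step (2 * m))
  (cong₂ _∷_ (cong (_≡ᵇ 1) (even%2 m)) (cong binaryDigits (even/2 m)))

evenBlocks : ℕ → Bool
evenBlocks n = noOddZeroBlock false (binaryDigits n)

verdict : Bool → ℕ
verdict true  = 1
verdict false = 0

baumSweet-verdict : ∀ n → baumSweet n ≡ verdict (evenBlocks n)
baumSweet-verdict zero = refl
baumSweet-verdict (suc n) with noOddZeroBlock false (binaryDigits (suc n))
... | true  = refl
... | false = refl

baumSweet-via-test : ∀ m n → evenBlocks m ≡ evenBlocks n → baumSweet m ≡ baumSweet n
baumSweet-via-test m n e =
  trans (baumSweet-verdict m) (trans (cong verdict e) (sym (baumSweet-verdict n)))

-- b (2n+1) = b n: a trailing 1 closes an empty block of 0's.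
baumSweet-odd : ∀ n → baumSweet (1 + 2 * n) ≡ baumSweet n
baumSweet-odd n = baumSweet-via-test (1 + 2 * n) n (cong (noOddZeroBlock false) (digits-odd n))

-- b (4n) = b n: two trailing 0's do not change the parity of the lowest block.
baumSweet-quadruple : ∀ n → baumSweet (4 * n) ≡ baumSweet n
baumSweet-quadruple zero = refl
baumSweet-quadruple n@(suc _) = baumSweet-via-test (4 * n) n (cong (noOddZeroBlock false) (begin
  binaryDigits (4 * n)             ≡⟨ cong binaryDigits (*-assoc 2 2 n) ⟩
  binaryDigits (2 * (2 * n))       ≡⟨ digits-double (2 * n) ⟩
  false ∷ binaryDigits (2 * n)     ≡⟨ cong (false ∷_) (digits-double n) ⟩
  false ∷ false ∷ binaryDigits n   ∎))

-- b (4n+2) = 0: the digits end in 10, an isolated 0.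
baumSweet-4n+2 : ∀ n → baumSweet (2 + 4 * n) ≡ 0
baumSweet-4n+2 n = trans (baumSweet-verdict (2 + 4 * n)) (cong (verdict ∘ noOddZeroBlock false) (begin
  binaryDigits (2 + 4 * n)          ≡⟨ cong binaryDigits (solve (n ∷ [])) ⟩
  binaryDigits (2 * (1 + 2 * n))    ≡⟨ digits-double (1 + 2 * n) ⟩
  false ∷ binaryDigits (1 + 2 * n)  ≡⟨ cong (false ∷_) (digits-odd n) ⟩
  false ∷ true ∷ binaryDigits n     ∎))

isolated-zero : ∀ x m → x ≡ 2 + 4 * m → baumSweet x ≡ 1 → ⊥
isolated-zero x m refl b≡1 with () ← trans (sym b≡1) (baumSweet-4n+2 m)

data Parity : ℕ → Set where
  even : ∀ j → Parity (2 * j)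
  odd  : ∀ j → Parity (1 + 2 * j)

parity : ∀ n → Parity n
parity zero = even 0
parity (suc n) with parity n
... | even j = odd j
... | odd j  = subst Parity (*-suc 2 j) (even (suc j))

-- x is rejected when scanning its digits fails whatever parity of 0's is
-- carried in from below: some odd block of 0's is closed by a 1 above it.
Rejected : ℕ → Set
Rejected x = ∀ p → noOddZeroBlock p (binaryDigits x) ≡ false

-- 5 = 101₂: its single 0 forms an odd block closed by a 1.
rejected-five : Rejected 5
rejected-five true  = refl
rejected-five false = refl

rejected⇒zero : ∀ x → Rejected x → baumSweet x ≡ 0
rejected⇒zero x r = trans (baumSweet-verdict x) (cong verdict (r false))

-- A low digit 1 passes parity "even" to the digits above, which reject it.
rejected-odd : ∀ m → Rejected m → Rejected (1 + 2 * m)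
rejected-odd m r p rewrite digits-odd m | r false = ∧-zeroʳ (not p)

-- A low digit 0 only flips the carried parity; 0 has no digits, so is
-- never rejected.
rejected-double : ∀ m → Rejected m → Rejected (2 * m)
rejected-double zero    r p with () ← r false
rejected-double m@(suc _) r p rewrite digits-double m {{_}} = r (not p)

RejectedRun : ℕ → ℕ → Set
RejectedRun n k = ∀ i → i < k → Rejected (n + i)

-- Doubling a run of length k starting at n gives one of length 2k at 2n:
-- 2n + 2j and 2n + 2j + 1 come from n + j by appending a digit.
run-double : ∀ n k → RejectedRun n k → RejectedRun (2 * n) (2 * k)
run-double n k run i i<2k with parity i
... | even j = subst Rejected (*-distribˡ-+ 2 n j)
  (rejected-double (n + j) (run j (*-cancelˡ-< 2 j k i<2k)))
... | odd j  = subst Rejected odd-shift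
  (rejected-odd (n + j) (run j (*-cancelˡ-< 2 j k (<-trans (n<1+n (2 * j)) i<2k))))
  where
  odd-shift : 1 + 2 * (n + j) ≡ 2 * n + (1 + 2 * j)
  odd-shift = solve (n ∷ j ∷ [])

-- Runs of rejected numbers of every positive length: start with the run
-- of length 1 at 5 and double.
rejected-runs : ∀ k → ∃[ n ] RejectedRun n (suc k)
rejected-runs zero = 5 , λ { zero _ → rejected-five ; (suc _) (s≤s ()) }
rejected-runs (suc k) with rejected-runs k
... | n , run = 2 * n , λ i i<2+k → run-double n (suc k) run i (<-≤-trans i<2+k 2+k≤2[1+k])
  where
  2+k≤2[1+k] : 2 + k ≤ 2 * (1 + k)
  2+k≤2[1+k] = subst (2 + k ≤_) (sym (*-suc 2 k)) (+-monoʳ-≤ 2 (m≤n*m k 2))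

zero-runs : ∀ k → ∃[ n ] ((i : ℕ) → i < k → baumSweet (n + i) ≡ 0)
zero-runs k with rejected-runs k
... | n , run = n , λ i i<k → rejected⇒zero (n + i) (run i (m<n⇒m<1+n i<k))

data Residue4 : ℕ → Set where
  rem0 : ∀ q → Residue4 (4 * q)
  rem1 : ∀ q → Residue4 (1 + 4 * q)
  rem2 : ∀ q → Residue4 (2 + 4 * q)
  rem3 : ∀ q → Residue4 (3 + 4 * q)

residue4 : ∀ n → Residue4 n
residue4 0 = rem0 0
residue4 1 = rem1 0
residue4 2 = rem2 0
residue4 3 = rem3 0
residue4 (suc (suc (suc (suc n)))) with residue4 n
... | rem0 q = subst Residue4 (*-suc 4 q) (rem0 (suc q))
... | rem1 q = subst Residue4 (cong (1 +_) (*-suc 4 q)) (rem1 (suc q))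
... | rem2 q = subst Residue4 (cong (2 +_) (*-suc 4 q)) (rem2 (suc q))
... | rem3 q = subst Residue4 (cong (3 +_) (*-suc 4 q)) (rem3 (suc q))

-- At u = 4w+3 the recurrences carry the values at u, u+1, 2(u+1) back to
-- those at w, w+1, 2(w+1).
carry-3mod4 : ∀ w → baumSweet (3 + 4 * w) ≡ baumSweet w
carry-3mod4 w = begin
  baumSweet (3 + 4 * w)            ≡⟨ cong baumSweet 3+4w≡1+2[1+2w] ⟩
  baumSweet (1 + 2 * (1 + 2 * w))  ≡⟨ baumSweet-odd (1 + 2 * w) ⟩
  baumSweet (1 + 2 * w)            ≡⟨ baumSweet-odd w ⟩
  baumSweet w                      ∎
  where
  3+4w≡1+2[1+2w] : 3 + 4 * w ≡ 1 + 2 * (1 + 2 * w)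
  3+4w≡1+2[1+2w] = solve (w ∷ [])

carry-successor : ∀ w → baumSweet (4 + 4 * w) ≡ baumSweet (1 + w)
carry-successor w = trans (cong baumSweet (sym (*-suc 4 w))) (baumSweet-quadruple (1 + w))

carry-double : ∀ w → baumSweet (2 * (4 + 4 * w)) ≡ baumSweet (2 * (1 + w))
carry-double w = trans (cong baumSweet 8+8w≡4[2+2w]) (baumSweet-quadruple (2 * (1 + w)))
  where
  8+8w≡4[2+2w] : 2 * (4 + 4 * w) ≡ 4 * (2 * (1 + w))
  8+8w≡4[2+2w] = solve (w ∷ [])

NoOneTriple : ℕ → Set
NoOneTriple u = baumSweet u ≡ 1 → baumSweet (1 + u) ≡ 1 → baumSweet (2 * (1 + u)) ≡ 1 → ⊥

-- By strong induction: for u ≡ 0, 1, 2 mod 4 one of the three positions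
-- is ≡ 2 mod 4; for u = 4w+3 the triple carries back to the one at w < u.
no-one-triple : ∀ u → NoOneTriple u
no-one-triple = <-rec NoOneTriple step
  where
  step : ∀ u → (∀ {w} → w < u → NoOneTriple w) → NoOneTriple u
  step u smaller with residue4 u
  ... | rem0 q = λ _ _ h → isolated-zero (2 * (1 + 4 * q)) (2 * q) (solve (q ∷ [])) h
  ... | rem1 q = λ _ h _ → isolated-zero (2 + 4 * q) q refl h
  ... | rem2 q = λ _ _ h → isolated-zero (2 * (3 + 4 * q)) (1 + 2 * q) (solve (q ∷ [])) h
  ... | rem3 w = λ h₀ h₁ h₂ → smaller w<u
    (trans (sym (carry-3mod4 w)) h₀)
    (trans (sym (carry-successor w)) h₁)
    (trans (sym (carry-double w)) h₂)
    where
    w<u : w < 3 + 4 * w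
    w<u = s≤s (≤-trans (m≤n*m w 4) (m≤n+m (4 * w) 2))

-- No three consecutive terms equal 1: one of n, n+1, n+2 is ≡ 2 mod 4,
-- except for n = 4q+3, where the three terms are those of the triple at q.
no-three-ones : ∀ n → ¬ ((i : ℕ) → i < 3 → baumSweet (n + i) ≡ 1)
no-three-ones n ones with residue4 n
... | rem0 q = isolated-zero (4 * q + 2) q (+-comm (4 * q) 2) (ones 2 (s<s (s<s z<s)))
... | rem1 q = isolated-zero (1 + 4 * q + 1) q (solve (q ∷ [])) (ones 1 (s<s z<s))
... | rem2 q = isolated-zero (2 + 4 * q + 0) q (+-identityʳ (2 + 4 * q)) (ones 0 z<s)
... | rem3 q = no-one-triple q
  (trans (sym (carry-3mod4 q)) (one-at 0 z<s (3 + 4 * q) (+-identityʳ (3 + 4 * q))))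
  (trans (sym (carry-successor q)) (one-at 1 (s<s z<s) (4 + 4 * q) (solve (q ∷ []))))
  (trans (sym (baumSweet-odd (2 * (1 + q))))
         (one-at 2 (s<s (s<s z<s)) (1 + 2 * (2 * (1 + q))) (solve (q ∷ []))))
  where
  one-at : ∀ i → i < 3 → ∀ x → 3 + 4 * q + i ≡ x → baumSweet x ≡ 1
  one-at i i<3 x refl = ones i i<3

mainTheorem1 : ((k : ℕ) → ∃[ n ] ((i : ℕ) → i < k → baumSweet (n + i) ≡ 0))
    × ((∃[ n ] ((i : ℕ) → i < 2 → baumSweet (n + i) ≡ 1))
    × ((n m : ℕ) → ((i : ℕ) → i < m → baumSweet (n + i) ≡ 1) → m ≤ 2))
mainTheorem1 = zero-runs , (0 , ones-at-start) , runs-of-ones-bounded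
  where
  ones-at-start : (i : ℕ) → i < 2 → baumSweet (0 + i) ≡ 1
  ones-at-start 0 _ = refl
  ones-at-start 1 _ = refl
  ones-at-start (suc (suc _)) (s≤s (s≤s ()))

  runs-of-ones-bounded : (n m : ℕ) → ((i : ℕ) → i < m → baumSweet (n + i) ≡ 1) → m ≤ 2
  runs-of-ones-bounded n m ones = ≮⇒≥ λ 2<m →
    no-three-ones n (λ i i<3 → ones i (<-≤-trans i<3 2<m))
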